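{- Let $\mathcal{P}$ be a set of participants, $G$ a bounded global type, $N$ a network and $M$ a queue. If $\vdash_{\mathcal{P}} G : N\parallel M$ and $p\in\mathrm{Plays}(N)\cap\mathcal{P}$, then $p\in\mathrm{Plays}(G)$.
   Context: Labels are ranged over by $\lambda$, participants by $p,q,r,s$. Processes are the possibly infinite but regular (finitely many distinct subterms) terms coinductively generated by $P ::= \mathbf{0} \mid q!\{\lambda_i.P_i\}_{i\in I} \mid q?\{\lambda_i.P_i\}_{i\in I}$, with $I$ finite and nonempty and the $\lambda_i$ pairwise distinct (output to $q$, resp. input from $q$, of one of the labels, continuing as $P_i$). $\mathrm{plays}(P)$ is the smallest set with $\mathrm{plays}(\mathbf{0})=\emptyset$ and $\mathrm{plays}(q!\{\lambda_i.P_i\}_{i\in I})=\mathrm{plays}(q?\{\lambda_i.P_i\}_{i\in I})=\{q\}\cup\bigcup_{i\in I}\mathrm{plays}(P_i)$. A message is a triple $(p,\lambda,q)$ (sender $p$, label $\lambda$, receiver $q$). A queue $M$ is a finite sequence of messages ($\emptyset$ empty, $\cdot$ concatenation), taken modulo the equivalence that swaps two adjacent messages $(p,\lambda,q)$ and $(r,\lambda',s)$ whenever $p\neq r$ or $q\neq s$. A network is $N=p_1[P_1]\parallel\cdots\parallel p_n[P_n]$ with the $p_h$ pairwise distinct and $p_h\notin\mathrm{plays}(P_h)$, taken modulo permutation of components and adding/removing components $p[\mathbf{0}]$. We write $p[P]\in N$ if $P\neq\mathbf{0}$ and $N\equiv p[P]\parallel N'$ for some $N'$; $\mathrm{Plays}(N)=\{p\mid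 p[P]\in N\}$. A session is $N\parallel M$. Communications are $pq!\lambda$ and $pq?\lambda$ with $\mathrm{play}(pq!\lambda)=\mathrm{play}(pq?\lambda)=p$. Global types are regular coinductive terms $G ::= pq!\{\lambda_i.G_i\}_{i\in I} \mid pq?\lambda.G \mid \mathsf{End}$ with $p\neq q$, $I$ nonempty, labels pairwise distinct; $pq!\{\lambda_i.G_i\}$ means $p$ sends some $\lambda_i$ to $q$ then $G_i$; $pq?\lambda.G$ means $p$ reads $\lambda$ sent by $q$ then $G$. $\mathrm{Plays}(G)$ is the smallest set with $\mathrm{Plays}(\mathsf{End})=\emptyset$, $\mathrm{Plays}(pq!\{\lambda_i.G_i\}_{i\in I})=\{p\}\cup\bigcup_i\mathrm{Plays}(G_i)$, $\mathrm{Plays}(pq?\lambda.G)=\{p\}\cup\mathrm{Plays}(G)$. $\mathrm{Paths}(G)$ is the greatest set of finite or infinite sequences of communications with $\mathrm{Paths}(\mathsf{End})=\{\epsilon\}$, $\mathrm{Paths}(pq!\{\lambda_i.G_i\}_{i\in I})=\bigcup_{i}\{pq!\lambda_i\cdot\xi\mid\xi\in\mathrm{Paths}(G_i)\}$, $\mathrm{Paths}(pq?\lambda.G)=\{pq?\lambda\cdot\xi\mid \xi\in\mathrm{Paths}(G)\}$; $\xi[n]$ is the $n$-th communication of $\xi$. $\mathrm{depth}(\xi,p)=\inf\{n\mid\mathrm{play}(\xi[n])=p\}$ (with $\inf\emptyset=\infty$); $\mathrm{depth}(G,p)=\sup\{\mathrm{depth}(\xi,p)\mid\xi\in\mathrm{Paths}(G)\}$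 if $p\in\mathrm{Plays}(G)$, and $0$ otherwise. $G$ is bounded if $\mathrm{depth}(G',p)$ is finite for every $p\in\mathrm{Plays}(G)$ and every global type $G'$ occurring in $G$. Weight of a message: $\mathrm{wg}((p,\lambda,q),G)=0$ if $G=qp?\lambda.G'$; $=\infty$ if $G=\mathsf{End}$ or $G=qp?\lambda'.G'$ with $\lambda'\neq\lambda$; $=1+\max_{i\in I}\mathrm{wg}((p,\lambda,q),G_i)$ if $G=rs!\{\lambda_i.G_i\}_{i\in I}$; $=1+\mathrm{wg}((p,\lambda,q),G')$ if $G=rs?\lambda'.G'$ with $r\neq q$ or $s\neq p$. A type configuration $G\parallel M$ is $\mathcal{P}$-sound if $\mathrm{wg}((p,\lambda,q),G)$ is finite for every message $(p,\lambda,q)$ occurring in $M$ with $\{p,q\}\subseteq\mathcal{P}$. A history $H$ is a finite set of pairs $(N\parallel M, G)$; $(N\parallel -,G)\in H$ means $(N\parallel M,G)\in H$ for some $M$; $H,(S,G)$ denotes $H\cup\{(S,G)\}$. Judgements $H\vdash_{\mathcal{P}} G : N\parallel M$ (with $G$ bounded) are derived inductively (finite derivations) by: (End) $H\vdash_{\mathcal{P}}\mathsf{End}:N\parallel M$ if $\mathrm{Plays}(N)\cap\mathcal{P}=\emptyset$ and $\mathsf{End}\parallel M$ is $\mathcal{P}$-sound. (Cycle) $H\vdash_{\mathcal{P}} G:N\parallel M$ if $(N\parallel M,G)\in H$. (Out) if $G=pq!\{\lambda_i.G_i\}_{i\in I}$, $P=q!\{\lambda_i.P_i\}_{i\in I}$,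 $G\parallel M$ is $\mathcal{P}$-sound, $(p[P]\parallel N\parallel -,G)\notin H$, $(\mathrm{Plays}(N)\setminus\mathrm{Plays}(G))\cap\mathcal{P}=\emptyset$, and $H,(p[P]\parallel N\parallel M,G)\vdash_{\mathcal{P}} G_i : p[P_i]\parallel N\parallel M\cdot(p,\lambda_i,q)$ for all $i\in I$, then $H\vdash_{\mathcal{P}} G:p[P]\parallel N\parallel M$. (In) if $G=pq?\lambda_h.G'$, $P=q?\{\lambda_i.P_i\}_{i\in I}$ with $h\in I$, $G'\parallel M$ is $\mathcal{P}$-sound, $(p[P]\parallel N\parallel -,G)\notin H$, $(\mathrm{Plays}(N)\setminus\mathrm{Plays}(G))\cap\mathcal{P}=\emptyset$, and $H,(p[P]\parallel N\parallel M,G)\vdash_{\mathcal{P}}G':p[P_h]\parallel N\parallel M$, then $H\vdash_{\mathcal{P}} G : p[P]\parallel N\parallel (q,\lambda_h,p)\cdot M$. We write $\vdash_{\mathcal{P}} G:N\parallel M$ when the judgement is derivable with empty history. -}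

module Defs where

open import Data.Nat using (ℕ; zero; suc; _≤_; _<_; _≟_)
open import Data.Product using (Σ; ∃; _×_; _,_; proj₁; proj₂)
open import Data.Sum using (_⊎_)
open import Data.List using (List; []; _∷_; _++_; map; length)
open import Data.List.Membership.Propositional using (_∈_)
open import Data.List.Relation.Unary.Any using (Any)
open import Data.List.Relation.Unary.All using (All)
open import Data.List.Relation.Unary.Unique.Propositional using (Unique)
open import Relation.Binary.PropositionalEquality using (_≡_; _≢_)
open import Relation.Nullary using (¬_; yes; no)
open import Relation.Binary.Construct.Closure.Equivalence using (EqClosure)

Part : Set
Part = ℕ

Label : Set
Label = ℕ

labels : {A : Set} → List (Label × A) → List Label
labels = map proj₁

-- Processes: coinductive terms (regularity is a separate predicate)
-- pout q bs  =  q!{λ_i.P_i}_{i∈I},   pin q bs  =  q?{λ_i.P_i}_{i∈I}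
-- with I finite (a list), nonempty, labels pairwise distinct.

mutual
  record Proc : Set where
    coinductive
    field node : ProcF

  data ProcF : Set where
    end  : ProcF
    pout : (q : Part) (bs : List (Label × Proc)) →
           0 < length bs → Unique (labels bs) → ProcF
    pin  : (q : Part) (bs : List (Label × Proc)) →
           0 < length bs → Unique (labels bs) → ProcF

open Proc public

𝟘 : Proc
node 𝟘 = end

IsEnd : Proc → Set
IsEnd P = node P ≡ end

-- bisimilarity (equality of coinductive terms)
mutual
  record _≈P_ (P Q : Proc) : Set where
    coinductive
    field force : ProcRel (node P) (node Q)

  data ProcRel : ProcF → ProcF → Set where
    end : ProcRel end end
    out : ∀ {q bs ne u bs' ne' u'} →
          (∀ {l P} → (l , P) ∈ bs → ∃ λ P' → (l , P') ∈ bs' × P ≈P P') →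
          (∀ {l P'} → (l , P') ∈ bs' → ∃ λ P → (l , P) ∈ bs × P ≈P P') →
          ProcRel (pout q bs ne u) (pout q bs' ne' u')
    inp : ∀ {q bs ne u bs' ne' u'} →
          (∀ {l P} → (l , P) ∈ bs → ∃ λ P' → (l , P') ∈ bs' × P ≈P P') →
          (∀ {l P'} → (l , P') ∈ bs' → ∃ λ P → (l , P) ∈ bs × P ≈P P') →
          ProcRel (pin q bs ne u) (pin q bs' ne' u')

open _≈P_ public

data ChildP (C : Proc) : Proc → Set where
  out : ∀ {P q bs ne u l} → node P ≡ pout q bs ne u → (l , C) ∈ bs → ChildP C P
  inp : ∀ {P q bs ne u l} → node P ≡ pin q bs ne u → (l , C) ∈ bs → ChildP C P

-- regular: finitely many distinct subterms (up to bisimilarity)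
RegularP : Proc → Set
RegularP P = Σ (List Proc) λ L →
  Any (P ≈P_) L × All (λ Q → ∀ C → ChildP C Q → Any (C ≈P_) L) L

data _∈plays_ (r : Part) (P : Proc) : Set where
  out-here  : ∀ {bs ne u} → node P ≡ pout r bs ne u → r ∈plays P
  inp-here  : ∀ {bs ne u} → node P ≡ pin r bs ne u → r ∈plays P
  child     : ∀ {C} → ChildP C P → r ∈plays C → r ∈plays P

Msg : Set
Msg = Part × Label × Part

Queue : Set
Queue = List Msg

data Swap : Queue → Queue → Set where
  swap : ∀ A B p l q r l' s → (p ≢ r ⊎ q ≢ s) →
         Swap (A ++ (p , l , q) ∷ (r , l' , s) ∷ B) (A ++ (r , l' , s) ∷ (p , l , q) ∷ B)

_≈Q_ : Queue → Queue → Set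
_≈Q_ = EqClosure Swap

-- Networks: p₁[P₁] ∥ ⋯ ∥ pₙ[Pₙ] as a list of components,
-- compared modulo permutation and p[0] components via lookup.

Network : Set
Network = List (Part × Proc)

lookupN : Network → Part → Proc
lookupN [] p = 𝟘
lookupN ((q , P) ∷ N) p with q ≟ p
... | yes _ = P
... | no  _ = lookupN N p

WFNet : Network → Set
WFNet N = Unique (map proj₁ N) ×
          All (λ c → ¬ (proj₁ c ∈plays proj₂ c) × RegularP (proj₂ c)) N

_≈N_ : Network → Network → Set
N ≈N N' = ∀ p → lookupN N p ≈P lookupN N' p

-- p ∈ Plays(N)  iff  p[P] ∈ N with P ≠ 0
_∈PlaysN_ : Part → Network → Set
p ∈PlaysN N = ¬ IsEnd (lookupN N p)

mutual
  record GT : Set where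
    coinductive
    field gnode : GTF

  data GTF : Set where
    gend : GTF
    gout : (p q : Part) → p ≢ q → (bs : List (Label × GT)) →
           0 < length bs → Unique (labels bs) → GTF
    gin  : (p q : Part) → p ≢ q → Label → GT → GTF

open GT public

mutual
  record _≈G_ (G G' : GT) : Set where
    coinductive
    field gforce : GTRel (gnode G) (gnode G')

  data GTRel : GTF → GTF → Set where
    end : GTRel gend gend
    out : ∀ {p q d d' bs ne u bs' ne' u'} →
          (∀ {l G} → (l , G) ∈ bs → ∃ λ G' → (l , G') ∈ bs' × G ≈G G') →
          (∀ {l G'} → (l , G') ∈ bs' → ∃ λ G → (l , G) ∈ bs × G ≈G G') →
          GTRel (gout p q d bs ne u) (gout p q d' bs' ne' u')
    inp : ∀ {p q d d' l G G'} → G ≈G G' → GTRel (gin p q d l G) (gin p q d' l G')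

open _≈G_ public

data ChildG (C : GT) : GT → Set where
  out : ∀ {G p q d bs ne u l} → gnode G ≡ gout p q d bs ne u → (l , C) ∈ bs → ChildG C G
  inp : ∀ {G p q d l} → gnode G ≡ gin p q d l C → ChildG C G

RegularG : GT → Set
RegularG G = Σ (List GT) λ L →
  Any (G ≈G_) L × All (λ G₁ → ∀ C → ChildG C G₁ → Any (C ≈G_) L) L

data _∈PlaysG_ (r : Part) (G : GT) : Set where
  out-here : ∀ {q d bs ne u} → gnode G ≡ gout r q d bs ne u → r ∈PlaysG G
  inp-here : ∀ {q d l G'} → gnode G ≡ gin r q d l G' → r ∈PlaysG G
  child    : ∀ {C} → ChildG C G → r ∈PlaysG C → r ∈PlaysG G

data Occurs : GT → GT → Set where
  self : ∀ {G} → Occurs G G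
  sub  : ∀ {C G₁ G} → ChildG C G₁ → Occurs G₁ G → Occurs C G

data Comm : Set where
  snd : Part → Part → Label → Comm
  rcv : Part → Part → Label → Comm

play : Comm → Part
play (snd p _ _) = p
play (rcv p _ _) = p

mutual
  record Colist : Set where
    coinductive
    field cout : ColistF

  data ColistF : Set where
    []  : ColistF
    _∷_ : Comm → Colist → ColistF

open Colist public

mutual
  record IsPath (G : GT) (ξ : Colist) : Set where
    coinductive
    field pforce : IsPathF (gnode G) (cout ξ)

  data IsPathF : GTF → ColistF → Set where
    end : IsPathF gend []
    out : ∀ {p q d bs ne u l G ξ} → (l , G) ∈ bs → IsPath G ξ →
          IsPathF (gout p q d bs ne u) (snd p q l ∷ ξ)
    inp : ∀ {p q d l G ξ} → IsPath G ξ →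
          IsPathF (gin p q d l G) (rcv p q l ∷ ξ)

open IsPath public

-- play(ξ[n]) = p   (positions counted from 0)
data PlayAt (p : Part) : Colist → ℕ → Set where
  here  : ∀ {ξ c ξ'} → cout ξ ≡ c ∷ ξ' → play c ≡ p → PlayAt p ξ zero
  there : ∀ {ξ c ξ' n} → cout ξ ≡ c ∷ ξ' → PlayAt p ξ' n → PlayAt p ξ (suc n)

-- depth(G,p) is finite: 0 if p ∉ Plays(G); otherwise
-- sup_{ξ ∈ Paths(G)} inf{n | play(ξ[n]) = p} is bounded by some k
DepthFinite : GT → Part → Set
DepthFinite G p = p ∈PlaysG G →
  ∃ λ k → ∀ ξ → IsPath G ξ → ∃ λ n → n ≤ k × PlayAt p ξ n

Bounded : GT → Set
Bounded G = ∀ G' → Occurs G' G → ∀ p → p ∈PlaysG G → DepthFinite G' p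

-- Weight: wg((p,λ,q),G) is finite (inductive characterisation of finiteness
-- of the recursively defined weight)

data WgFin (p : Part) (l : Label) (q : Part) : GT → Set where
  hit  : ∀ {G d G'} → gnode G ≡ gin q p d l G' → WgFin p l q G
  sout : ∀ {G r s d bs ne u} → gnode G ≡ gout r s d bs ne u →
         (∀ {l' G'} → (l' , G') ∈ bs → WgFin p l q G') → WgFin p l q G
  sinp : ∀ {G r s d l' G'} → gnode G ≡ gin r s d l' G' → (r ≢ q ⊎ s ≢ p) →
         WgFin p l q G' → WgFin p l q G

ParticipantSet : Set₁
ParticipantSet = Part → Set

Sound : ParticipantSet → GT → Queue → Set
Sound 𝒫 G M = ∀ p l q → (p , l , q) ∈ M → 𝒫 p → 𝒫 q → WgFin p l q G

History : Set
History = List (Network × Queue × GT)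

InH : History → Network → Queue → GT → Set
InH H N M G = Any (λ e → (proj₁ e ≈N N) × (proj₁ (proj₂ e) ≈Q M) × (proj₂ (proj₂ e) ≈G G)) H

InH- : History → Network → GT → Set
InH- H N G = Any (λ e → (proj₁ e ≈N N) × (proj₂ (proj₂ e) ≈G G)) H

RestOK : ParticipantSet → Network → GT → Set
RestOK 𝒫 N G = ∀ r → r ∈PlaysN N → ¬ (r ∈PlaysG G) → ¬ 𝒫 r

data _⊢[_]_∶_∥_ (H : History) (𝒫 : ParticipantSet) : GT → Network → Queue → Set where
  End   : ∀ {G N M} → gnode G ≡ gend →
          (∀ r → r ∈PlaysN N → ¬ 𝒫 r) → Sound 𝒫 G M →
          H ⊢[ 𝒫 ] G ∶ N ∥ M
  Cycle : ∀ {G N M} → InH H N M G → H ⊢[ 𝒫 ] G ∶ N ∥ M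
  Out   : ∀ {G N' N M p q d bs ne u P bs' ne' u'} →
          gnode G ≡ gout p q d bs ne u →
          node P ≡ pout q bs' ne' u' →
          (∀ {l} → l ∈ labels bs → l ∈ labels bs') →
          (∀ {l} → l ∈ labels bs' → l ∈ labels bs) →
          IsEnd (lookupN N p) →                 -- N contains no p-component
          N' ≈N ((p , P) ∷ N) →
          Sound 𝒫 G M →
          ¬ InH- H N' G →
          RestOK 𝒫 N G →
          (∀ {l Gᵢ Pᵢ} → (l , Gᵢ) ∈ bs → (l , Pᵢ) ∈ bs' →
             ((N' , M , G) ∷ H) ⊢[ 𝒫 ] Gᵢ ∶ ((p , Pᵢ) ∷ N) ∥ (M ++ (p , l , q) ∷ [])) →
          H ⊢[ 𝒫 ] G ∶ N' ∥ M
  In    : ∀ {G G' N' N M' M p q d l P bs' ne' u' Pₕ} →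
          gnode G ≡ gin p q d l G' →
          node P ≡ pin q bs' ne' u' →
          (l , Pₕ) ∈ bs' →
          IsEnd (lookupN N p) →
          N' ≈N ((p , P) ∷ N) →
          M' ≈Q ((q , l , p) ∷ M) →
          Sound 𝒫 G' M →
          ¬ InH- H N' G →
          RestOK 𝒫 N G →
          ((N' , M' , G) ∷ H) ⊢[ 𝒫 ] G' ∶ ((p , Pₕ) ∷ N) ∥ M →
          H ⊢[ 𝒫 ] G ∶ N' ∥ M'

-- The last rule of a derivation with empty history is End, Out or In. End makes every active
-- participant lie outside 𝒫; Out and In make the moving participant play in G and, through
-- RestOK, forbid the other active participants of 𝒫 to lie outside Plays(G). This only yields
-- ¬ ¬ (p ∈ Plays(G)); to conclude constructively, membership in Plays(G) is decided. For a
-- regular G it is reachability of a subterm headed by p in the finite graph of subterms of G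
-- (up to bisimilarity), and reachability in a finite graph is decidable by saturation.
module Submission where

open import Defs
open import Data.List using (List; []; _∷_; map; length; lookup)
open import Data.Fin using (Fin)
import Data.Nat as ℕ
open import Data.Maybe using (Maybe; just; nothing)
open import Data.Product using (∃; _×_; _,_; proj₁; proj₂)
open import Data.Sum using (_⊎_; inj₁; inj₂; [_,_])
open import Level using (0ℓ; _⊔_)
open import Relation.Binary using (Rel)
open import Relation.Binary.Construct.Closure.ReflexiveTransitive using (Star; ε; _◅_; _◅◅_)
open import Relation.Binary.PropositionalEquality using (_≡_; _≢_; refl; sym; trans; cong; subst)
open import Relation.Nullary using (¬_; Dec; yes; no; ¬?; _×-dec_; _⊎-dec_; contradiction)
open import Relation.Nullary.Decidable using (decidable-stable; map′)
open import Relation.Unary using (Pred; Decidable)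

module FiniteReachability {n a b} {E : Rel (Fin n) a} (E? : ∀ i j → Dec (E i j))
                          {T : Pred (Fin n) b} (T? : Decidable T) where

  open import Data.Fin.Properties using (_≟_; any?)
  open import Data.Fin.Subset using (Subset; ⊤; _∈_; _∉_; _⊂_; _-_)
  open import Data.Fin.Subset.Properties using (_∈?_; ∈⊤; x∈p⇒p-x⊂p; x∈p∧x≢y⇒x∈p-y)
  open import Data.Fin.Subset.Induction using (Acc; acc; ⊂-wellFounded)

  Reach : Pred (Fin n) (a ⊔ b)
  Reach i = ∃ λ j → Star E i j × T j

  ◅-Reach : ∀ {i j} → E i j → Reach j → Reach i
  ◅-Reach e (k , path , t) = k , e ◅ path , t

  Closed : Subset n → Set (a ⊔ b)
  Closed U = ∀ {i} → i ∈ U → ¬ T i × (∀ {j} → E i j → j ∈ U)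

  closed⇒¬Reach : ∀ {U i} → Closed U → i ∈ U → ¬ Reach i
  closed⇒¬Reach closed i∈U (_ , ε , t) = proj₁ (closed i∈U) t
  closed⇒¬Reach closed i∈U (_ , e ◅ path , t) =
    closed⇒¬Reach closed (proj₂ (closed i∈U) e) (_ , path , t)

  Escapes : Subset n → Pred (Fin n) (a ⊔ b)
  Escapes U i = i ∈ U × (T i ⊎ ∃ λ j → E i j × j ∉ U)

  escapes? : ∀ U → Decidable (Escapes U)
  escapes? U i = i ∈? U ×-dec (T? i ⊎-dec any? (λ j → E? i j ×-dec ¬? (j ∈? U)))

  -- U is the set of nodes not yet known to reach T; it shrinks until no node escapes it.
  saturate : ∀ U → Acc _⊂_ U → (∀ {i} → i ∉ U → Reach i) →
             ∃ λ V → (∀ {i} → i ∉ V → Reach i) × Closed V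
  saturate U (acc shrink) reach with any? (escapes? U)
  ... | yes (i , i∈U , escape) = saturate (U - i) (shrink (x∈p⇒p-x⊂p i∈U)) reach′
    where
    reach′ : ∀ {k} → k ∉ U - i → Reach k
    reach′ {k} k∉U-i with k ≟ i
    ... | yes refl = [ (λ t → i , ε , t) , (λ (j , e , j∉U) → ◅-Reach e (reach j∉U)) ] escape
    ... | no k≢i = reach (λ k∈U → k∉U-i (x∈p∧x≢y⇒x∈p-y k∈U k≢i))
  ... | no stuck = U , reach , closed
    where
    closed : Closed U
    closed {i} i∈U =
      (λ t → stuck (i , i∈U , inj₁ t)) ,
      (λ {j} e → decidable-stable (j ∈? U) (λ j∉U → stuck (i , i∈U , inj₂ (j , e , j∉U))))

  Reach? : Decidable Reach
  Reach? i with saturate ⊤ (⊂-wellFounded ⊤) (λ i∉⊤ → contradiction ∈⊤ i∉⊤)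
  ... | V , reach , closed with i ∈? V
  ...   | yes i∈V = no (closed⇒¬Reach closed i∈V)
  ...   | no i∉V = yes (reach i∉V)

open import Data.List.Membership.Propositional using (_∈_; mapWith∈)
open import Data.List.Membership.Propositional.Properties using (∈-map⁺; ∈-map⁻; ∈-lookup)
open import Data.List.Relation.Unary.Any using (Any; here; index)
open import Data.List.Relation.Unary.Any.Properties using (lookup-index; mapWith∈⁺; mapWith∈⁻)
import Data.List.Relation.Unary.All as All

player : GTF → Maybe Part
player gend = nothing
player (gout p _ _ _ _ _) = just p
player (gin p _ _ _ _) = just p

kids : GTF → List GT
kids gend = []
kids (gout _ _ _ bs _ _) = map proj₂ bs
kids (gin _ _ _ _ G) = G ∷ []

child⇒∈kids : ∀ {C G} → ChildG C G → C ∈ kids (gnode G)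
child⇒∈kids (out G≡ C∈bs) rewrite G≡ = ∈-map⁺ proj₂ C∈bs
child⇒∈kids (inp G≡) rewrite G≡ = here refl

∈kids⇒child : ∀ {C} G → C ∈ kids (gnode G) → ChildG C G
∈kids⇒child G C∈ with gnode G in G≡
∈kids⇒child G C∈ | gout _ _ _ _ _ _ with ∈-map⁻ proj₂ C∈
... | _ , C∈bs , refl = out G≡ C∈bs
∈kids⇒child G (here refl) | gin _ _ _ _ _ = inp G≡

player⇒∈PlaysG : ∀ {p} G → player (gnode G) ≡ just p → p ∈PlaysG G
player⇒∈PlaysG G head with gnode G in G≡
player⇒∈PlaysG G refl | gout _ _ _ _ _ _ = out-here G≡
player⇒∈PlaysG G refl | gin _ _ _ _ _ = inp-here G≡

player-≈ : ∀ {x y} → GTRel x y → player x ≡ player y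
player-≈ end = refl
player-≈ (out _ _) = refl
player-≈ (inp _) = refl

kids-≈ : ∀ {x y C} → GTRel x y → C ∈ kids x → ∃ λ C′ → C′ ∈ kids y × C ≈G C′
kids-≈ (out there-to _) C∈ with ∈-map⁻ proj₂ C∈
... | _ , C∈bs , refl with there-to C∈bs
...   | C′ , C′∈bs′ , C≈C′ = C′ , ∈-map⁺ proj₂ C′∈bs′ , C≈C′
kids-≈ (inp C≈C′) (here refl) = _ , here refl , C≈C′

kids-≈⁻ : ∀ {x y C′} → GTRel x y → C′ ∈ kids y → ∃ λ C → C ∈ kids x × C ≈G C′
kids-≈⁻ (out _ back-to) C′∈ with ∈-map⁻ proj₂ C′∈
... | _ , C′∈bs′ , refl with back-to C′∈bs′
...   | C , C∈bs , C≈C′ = C , ∈-map⁺ proj₂ C∈bs , C≈C′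
kids-≈⁻ (inp C≈C′) (here refl) = _ , here refl , C≈C′

∈PlaysG-resp-≈⁻ : ∀ {p G G′} → G ≈G G′ → p ∈PlaysG G′ → p ∈PlaysG G
∈PlaysG-resp-≈⁻ {G = G} G≈G′ (out-here G′≡) =
  player⇒∈PlaysG G (trans (player-≈ (gforce G≈G′)) (cong player G′≡))
∈PlaysG-resp-≈⁻ {G = G} G≈G′ (inp-here G′≡) =
  player⇒∈PlaysG G (trans (player-≈ (gforce G≈G′)) (cong player G′≡))
∈PlaysG-resp-≈⁻ {G = G} G≈G′ (child ch p∈C′) with kids-≈⁻ (gforce G≈G′) (child⇒∈kids ch)
... | C , C∈ , C≈C′ = child (∈kids⇒child G C∈) (∈PlaysG-resp-≈⁻ C≈C′ p∈C′)

-- Transitivity of ≈G would need a corecursive proof, so chains of bisimilarities are carried instead.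
_≈G*_ : GT → GT → Set
_≈G*_ = Star _≈G_

player-≈* : ∀ {G K} → G ≈G* K → player (gnode G) ≡ player (gnode K)
player-≈* ε = refl
player-≈* (G≈H ◅ H≈*K) = trans (player-≈ (gforce G≈H)) (player-≈* H≈*K)

kids-≈* : ∀ {G K C} → G ≈G* K → C ∈ kids (gnode G) → ∃ λ C′ → C′ ∈ kids (gnode K) × C ≈G* C′
kids-≈* ε C∈ = _ , C∈ , ε
kids-≈* (G≈H ◅ H≈*K) C∈ with kids-≈ (gforce G≈H) C∈
... | C₁ , C₁∈ , C≈C₁ with kids-≈* H≈*K C₁∈
...   | C′ , C′∈ , C₁≈*C′ = C′ , C′∈ , C≈C₁ ◅ C₁≈*C′

module SubtermGraph {L : List GT} (closure : All.All (λ G → ∀ C → ChildG C G → Any (C ≈G_) L) L)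
                    (p : Part) where

  open import Data.Fin.Properties using (_≟_)
  open import Data.List.Membership.DecPropositional (_≟_ {length L}) using (_∈?_)
  open import Data.Maybe.Properties using (≡-dec)

  subterm : Fin (length L) → GT
  subterm = lookup L

  kid∈L : ∀ i {C} → C ∈ kids (gnode (subterm i)) → Any (C ≈G_) L
  kid∈L i C∈ = All.lookup closure (∈-lookup i) _ (∈kids⇒child (subterm i) C∈)

  kid-index : ∀ i {C} → C ∈ kids (gnode (subterm i)) → Fin (length L)
  kid-index i C∈ = index (kid∈L i C∈)

  succ : Fin (length L) → List (Fin (length L))
  succ i = mapWith∈ (kids (gnode (subterm i))) (kid-index i)

  succ-sound : ∀ {i j} → j ∈ succ i → ∃ λ C → C ∈ kids (gnode (subterm i)) × C ≈G subterm j
  succ-sound {i} j∈ with mapWith∈⁻ (kids (gnode (subterm i))) (kid-index i) j∈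
  ... | C , C∈ , refl = C , C∈ , lookup-index (kid∈L i C∈)

  succ-complete : ∀ {i C} → C ∈ kids (gnode (subterm i)) → ∃ λ j → j ∈ succ i × C ≈G subterm j
  succ-complete {i} C∈ =
    _ , mapWith∈⁺ (kid-index i) (_ , C∈ , refl) , lookup-index (kid∈L i C∈)

  Headed : Pred (Fin (length L)) 0ℓ
  Headed i = player (gnode (subterm i)) ≡ just p

  headed? : Decidable Headed
  headed? i = ≡-dec ℕ._≟_ (player (gnode (subterm i))) (just p)

  open FiniteReachability (λ i j → j ∈? succ i) headed? public using (Reach; ◅-Reach; Reach?)

  path⇒∈PlaysG : ∀ {i k} → Star (λ i j → j ∈ succ i) i k → Headed k → p ∈PlaysG subterm i
  path⇒∈PlaysG {i} ε headed = player⇒∈PlaysG (subterm i) headed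
  path⇒∈PlaysG {i} (j∈ ◅ path) headed with succ-sound j∈
  ... | C , C∈ , C≈ =
    child (∈kids⇒child (subterm i) C∈) (∈PlaysG-resp-≈⁻ C≈ (path⇒∈PlaysG path headed))

  Reach⇒∈PlaysG : ∀ {i} → Reach i → p ∈PlaysG subterm i
  Reach⇒∈PlaysG (_ , path , headed) = path⇒∈PlaysG path headed

  ∈PlaysG⇒Reach : ∀ {G i} → p ∈PlaysG G → G ≈G* subterm i → Reach i
  ∈PlaysG⇒Reach (out-here G≡) G≈* = _ , ε , trans (sym (player-≈* G≈*)) (cong player G≡)
  ∈PlaysG⇒Reach (inp-here G≡) G≈* = _ , ε , trans (sym (player-≈* G≈*)) (cong player G≡)
  ∈PlaysG⇒Reach (child ch p∈C) G≈* with kids-≈* G≈* (child⇒∈kids ch)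
  ... | C′ , C′∈ , C≈*C′ with succ-complete C′∈
  ...   | j , j∈ , C′≈ = ◅-Reach j∈ (∈PlaysG⇒Reach p∈C (C≈*C′ ◅◅ C′≈ ◅ ε))

∈PlaysG? : ∀ {G} → RegularG G → ∀ p → Dec (p ∈PlaysG G)
∈PlaysG? (L , G∈L , closure) p =
  map′ (λ r → ∈PlaysG-resp-≈⁻ (lookup-index G∈L) (Reach⇒∈PlaysG r))
       (λ p∈G → ∈PlaysG⇒Reach p∈G (lookup-index G∈L ◅ ε))
       (Reach? (index G∈L))
  where open SubtermGraph closure p

ProcRel-end : ∀ {x} → ProcRel x end → x ≡ end
ProcRel-end end = refl

IsEnd-resp-≈P : ∀ {P Q} → P ≈P Q → IsEnd Q → IsEnd P
IsEnd-resp-≈P P≈Q Q-end = ProcRel-end (subst (ProcRel _) Q-end (force P≈Q))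

lookupN-≢ : ∀ {q p} P N → q ≢ p → lookupN ((q , P) ∷ N) p ≡ lookupN N p
lookupN-≢ {q} {p} P N q≢p with q ℕ.≟ p
... | yes q≡p = contradiction q≡p q≢p
... | no _ = refl

∈PlaysN-tail : ∀ {N′ N q P p} → N′ ≈N ((q , P) ∷ N) → q ≢ p → p ∈PlaysN N′ → p ∈PlaysN N
∈PlaysN-tail {N = N} {P = P} N′≈ q≢p p∈N′ N-end =
  p∈N′ (IsEnd-resp-≈P (N′≈ _) (trans (cong node (lookupN-≢ P N q≢p)) N-end))

RestOK⇒¬¬∈PlaysG : ∀ {𝒫 G N′ N q P} → q ∈PlaysG G → N′ ≈N ((q , P) ∷ N) → RestOK 𝒫 N G →
                   ∀ p → p ∈PlaysN N′ → 𝒫 p → ¬ ¬ p ∈PlaysG G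
RestOK⇒¬¬∈PlaysG {N′ = N′} {N} {q} q∈G N′≈ rest p p∈N′ p∈𝒫 p∉G with q ℕ.≟ p
... | yes refl = p∉G q∈G
... | no q≢p = rest p (∈PlaysN-tail {N′} {N} N′≈ q≢p p∈N′) p∉G p∈𝒫

⊢⇒¬¬∈PlaysG : ∀ {𝒫 G N M} → [] ⊢[ 𝒫 ] G ∶ N ∥ M → ∀ p → p ∈PlaysN N → 𝒫 p → ¬ ¬ p ∈PlaysG G
⊢⇒¬¬∈PlaysG (End _ inactive _) p p∈N p∈𝒫 _ = inactive p p∈N p∈𝒫
⊢⇒¬¬∈PlaysG (Cycle ())
⊢⇒¬¬∈PlaysG {N = N′} (Out {N = N} G≡ _ _ _ _ N′≈ _ _ rest _) =
  RestOK⇒¬¬∈PlaysG {N′ = N′} {N} (out-here G≡) N′≈ rest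
⊢⇒¬¬∈PlaysG {N = N′} (In {N = N} G≡ _ _ _ N′≈ _ _ _ rest _) =
  RestOK⇒¬¬∈PlaysG {N′ = N′} {N} (inp-here G≡) N′≈ rest

lemma5 : (𝒫 : ParticipantSet) (G : GT) (N : Network) (M : Queue) →
    RegularG G → Bounded G → WFNet N →
    [] ⊢[ 𝒫 ] G ∶ N ∥ M →
    ∀ p → p ∈PlaysN N → 𝒫 p → p ∈PlaysG G
lemma5 𝒫 G N M regular _ _ ⊢G p p∈N p∈𝒫 =
  decidable-stable (∈PlaysG? regular p) (⊢⇒¬¬∈PlaysG ⊢G p p∈N p∈𝒫)
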